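{- For every integer $n\ge4$, $\gamma_{[2]R}(C_3\square P_n)\le 2n+2$.
   Context: $C_3$ is the cycle on 3 vertices, $P_n$ the path on $n$ vertices, and $\square$ the Cartesian product. For a labeling $f:V(G)\to\{0,1,2,3\}$, let $AN(v)=\{u\in N(v): f(u)>0\}$. The labeling $f$ is a $[2]$-Roman dominating function if every vertex $v$ with $f(v)<2$ satisfies $f(N[v])\ge 2+|AN(v)|$, where $N[v]=N(v)\cup\{v\}$ and $f(X)=\sum_{x\in X}f(x)$. $\gamma_{[2]R}(G)$ is the minimum of $\sum_v f(v)$ over all $[2]$-Roman dominating functions $f$ on $G$. -}

module Defs where

open import Data.Nat using (ℕ; zero; suc; _+_; _≤_; _<_; _≡ᵇ_)
open import Data.Fin using (Fin; toℕ)
open import Data.Bool using (Bool; true; false; _∧_; _∨_; not)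
open import Data.Nat.ListAction using (sum)
open import Data.List using (List; map; filter; length; cartesianProduct; allFin)
open import Data.Product using (_×_; _,_; proj₁; proj₂; Σ)
open import Relation.Nullary.Decidable using (does)
open import Data.Nat.Properties using (_≟_; _<?_)
open import Data.Fin.Properties using () renaming (_≟_ to _≟F_)

-- A finite simple graph: a finite vertex list enumerating all vertices
-- and a Boolean adjacency relation (assumed symmetric and irreflexive by
-- the concrete constructions below).
record Graph : Set₁ where
  field
    V     : Set
    verts : List V            -- enumeration of all vertices, each exactly once
    adj   : V → V → Bool

open Graph public

Labeling : Graph → Set
Labeling G = V G → Fin 4

val : {G : Graph} → Labeling G → V G → ℕ
val f v = toℕ (f v)

N : (G : Graph) → V G → List (V G)
N G v = filter (λ u → adj G v u ≟B true) (verts G)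
  where
    open import Data.Bool.Properties using () renaming (_≟_ to _≟B_)

AN : (G : Graph) → Labeling G → V G → List (V G)
AN G f v = filter (λ u → 0 <? val {G} f u) (N G v)

fN[_] : (G : Graph) → Labeling G → V G → ℕ
fN[ G ] f v = val {G} f v + sum (map (val {G} f) (N G v))

weight : (G : Graph) → Labeling G → ℕ
weight G f = sum (map (val {G} f) (verts G))

Is2RDF : (G : Graph) → Labeling G → Set
Is2RDF G f = ∀ v → val {G} f v < 2 → 2 + length (AN G f v) ≤ fN[ G ] f v

-- γ_[2]R(G) ≤ k  :⇔  some [2]RDF has weight ≤ k  (γ is the minimum weight)
γ[2]R≤ : Graph → ℕ → Set
γ[2]R≤ G k = Σ (Labeling G) λ f → Is2RDF G f × weight G f ≤ k

C3□P : ℕ → Graph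
C3□P n = record
  { V     = Fin 3 × Fin n
  ; verts = cartesianProduct (allFin 3) (allFin n)
  ; adj   = λ { (i , j) (i' , j') →
               (not (does (i ≟F i')) ∧ does (j ≟F j'))
             ∨ (does (i ≟F i') ∧ (((suc (toℕ j)) ≡ᵇ toℕ j') ∨ ((suc (toℕ j')) ≡ᵇ toℕ j))) }
  }

-- For any labeling f(N[v]) = f(v) + |AN(v)| + Σ_{u ∈ N(v)} (f(u) ∸ 1), so a vertex with f(v) < 2
-- is satisfied as soon as f(v) plus this surplus is at least 2.  Put a 2 in row c mod 3 of column c:
-- the next row (mod 3) sees that 2 and the 2 of column c + 1, the previous row sees that 2 and the
-- 2 of column c − 1.  Only the last and the first column lack one of these, and there the row
-- concerned gets 1 instead of 0.  Each column weighs 2 and the two end columns one more, so the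
-- weight is 2n + 2, for every n.
module Submission where

open import Defs
open import Data.Nat using (ℕ; zero; suc; _+_; _*_; _∸_; _≤_; _<_; z≤n; s≤s)
open import Data.Nat.Properties
  using (_≟_; _<?_; ≡⇒≡ᵇ; +-comm; +-assoc; *-comm; +-monoʳ-≤; +-mono-≤; m≤m+n; m≤n+m;
         ≤-trans; ≤-reflexive; ≤∧≢⇒<; +-0-commutativeMonoid; +-commutativeSemigroup;
         module ≤-Reasoning)
open import Data.Nat.ListAction using (sum)
open import Data.Nat.ListAction.Properties using (sum-++)
open import Data.Fin using (Fin; toℕ; fromℕ<; inject₁)
open import Data.Fin.Patterns using (0F; 1F; 2F)
open import Data.Fin.Properties using (toℕ<n; toℕ-fromℕ<; toℕ-inject₁) renaming (_≟_ to _≟F_)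
open import Data.Bool using (Bool; true; false; T)
open import Data.Bool.Properties using (T-≡; T-∨)
open import Data.List using (List; []; _∷_; map; filter; length; tabulate; _++_; cartesianProduct; allFin)
open import Data.List.Properties using (map-++; map-∘; map-tabulate)
open import Data.List.Membership.Propositional using (_∈_)
open import Data.List.Membership.Propositional.Properties using (∈-filter⁺; ∈-cartesianProduct⁺; ∈-allFin)
open import Data.List.Relation.Unary.Any using (here; there)
open import Data.Product using (Σ; _×_; _,_; proj₁)
open import Data.Sum as Sum using (_⊎_; inj₁; inj₂)
open import Data.Empty using (⊥-elim)
open import Function using (id; _∘_; Equivalence)
open import Relation.Nullary using (does; proof; yes; no)
open import Relation.Nullary.Reflects using (Reflects; ofʸ; ofⁿ)
open import Relation.Binary.PropositionalEquality using (_≡_; _≢_; refl; sym; trans; cong; cong₂; module ≡-Reasoning)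
open import Algebra.Properties.CommutativeSemigroup +-commutativeSemigroup using (x∙yz≈y∙xz)
open import Algebra.Properties.CommutativeMonoid.Sum +-0-commutativeMonoid
  using (sum-syntax; sum-cong-≗; sum-replicate-zero; ∑-comm; ∑-distrib-+)

open Equivalence using (to; from)

private
  variable
    A B : Set

sum-map≡length-positive+sum-map-pred : (h : A → ℕ) (xs : List A) →
  sum (map h xs) ≡ length (filter (λ x → 0 <? h x) xs) + sum (map (λ x → h x ∸ 1) xs)
sum-map≡length-positive+sum-map-pred h [] = refl
sum-map≡length-positive+sum-map-pred h (x ∷ xs) with h x
... | zero  = sum-map≡length-positive+sum-map-pred h xs
... | suc m = cong suc (begin
  m + sum (map h xs)  ≡⟨ cong (m +_) (sum-map≡length-positive+sum-map-pred h xs) ⟩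
  m + (ℓ + s)         ≡⟨ x∙yz≈y∙xz m ℓ s ⟩
  ℓ + (m + s)         ∎)
  where
  open ≡-Reasoning
  ℓ = length (filter (λ x → 0 <? h x) xs)
  s = sum (map (λ x → h x ∸ 1) xs)

∈⇒≤sum-map : (g : A → ℕ) {x : A} {xs : List A} → x ∈ xs → g x ≤ sum (map g xs)
∈⇒≤sum-map g {xs = y ∷ ys} (here refl) = m≤m+n (g y) _
∈⇒≤sum-map g {xs = y ∷ ys} (there x∈) = ≤-trans (∈⇒≤sum-map g x∈) (m≤n+m _ (g y))

∈-≢-∈⇒+≤sum-map : (g : A → ℕ) {x y : A} {xs : List A} →
  x ∈ xs → y ∈ xs → x ≢ y → g x + g y ≤ sum (map g xs)
∈-≢-∈⇒+≤sum-map g (here refl) (here refl) x≢y = ⊥-elim (x≢y refl)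
∈-≢-∈⇒+≤sum-map g {xs = z ∷ zs} (here refl) (there y∈) _ = +-monoʳ-≤ (g z) (∈⇒≤sum-map g y∈)
∈-≢-∈⇒+≤sum-map g {x} {xs = z ∷ zs} (there x∈) (here refl) _ =
  ≤-trans (≤-reflexive (+-comm (g x) (g z))) (+-monoʳ-≤ (g z) (∈⇒≤sum-map g x∈))
∈-≢-∈⇒+≤sum-map g {xs = z ∷ zs} (there x∈) (there y∈) x≢y =
  ≤-trans (∈-≢-∈⇒+≤sum-map g x∈ y∈ x≢y) (m≤n+m _ (g z))

sum-map-cartesianProduct : (h : A × B → ℕ) (xs : List A) (ys : List B) →
  sum (map h (cartesianProduct xs ys)) ≡ sum (map (λ x → sum (map (λ y → h (x , y)) ys)) xs)
sum-map-cartesianProduct h [] ys = refl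
sum-map-cartesianProduct h (x ∷ xs) ys = begin
  sum (map h (map (x ,_) ys ++ cartesianProduct xs ys))
    ≡⟨ cong sum (map-++ h (map (x ,_) ys) _) ⟩
  sum (map h (map (x ,_) ys) ++ map h (cartesianProduct xs ys))
    ≡⟨ sum-++ (map h (map (x ,_) ys)) _ ⟩
  sum (map h (map (x ,_) ys)) + sum (map h (cartesianProduct xs ys))
    ≡⟨ cong₂ _+_ (cong sum (sym (map-∘ ys))) (sum-map-cartesianProduct h xs ys) ⟩
  sum (map (λ y → h (x , y)) ys) + sum (map (λ x → sum (map (λ y → h (x , y)) ys)) xs)
    ∎
  where open ≡-Reasoning

sum-tabulate : ∀ {n} (g : Fin n → ℕ) → sum (tabulate g) ≡ ∑[ i < n ] g i
sum-tabulate {zero}  g = refl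
sum-tabulate {suc n} g = cong (g 0F +_) (sum-tabulate (g ∘ Fin.suc))

sum-map-allFin : ∀ {n} (g : Fin n → ℕ) → sum (map g (allFin n)) ≡ ∑[ i < n ] g i
sum-map-allFin {n} g = trans (cong sum (map-tabulate id g)) (sum-tabulate g)

sum-map-cartesianProduct-allFin : ∀ {m n} (h : Fin m × Fin n → ℕ) →
  sum (map h (cartesianProduct (allFin m) (allFin n))) ≡ ∑[ i < m ] ∑[ j < n ] h (i , j)
sum-map-cartesianProduct-allFin {m} {n} h =
  trans (sum-map-cartesianProduct h (allFin m) (allFin n))
        (trans (sum-map-allFin (λ i → sum (map (λ j → h (i , j)) (allFin n))))
               (sum-cong-≗ (λ i → sum-map-allFin (λ j → h (i , j)))))

∑-const : ∀ n c → ∑[ j < n ] c ≡ n * c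
∑-const zero    c = refl
∑-const (suc n) c = cong (c +_) (∑-const n c)

next-column : ∀ {n} (j : Fin n) → suc (toℕ j) ≢ n → Σ (Fin n) λ j′ → toℕ j′ ≡ suc (toℕ j)
next-column j notLast = fromℕ< j+1<n , toℕ-fromℕ< j+1<n
  where j+1<n = ≤∧≢⇒< (toℕ<n j) notLast

previous-column : ∀ {n} (j : Fin n) → toℕ j ≢ 0 → Σ (Fin n) λ j′ → toℕ j ≡ suc (toℕ j′)
previous-column Fin.zero    notFirst = ⊥-elim (notFirst refl)
previous-column (Fin.suc j) _        = inject₁ j , cong suc (sym (toℕ-inject₁ j))

surplus : (G : Graph) → Labeling G → V G → ℕ
surplus G f v = sum (map (λ u → val {G} f u ∸ 1) (N G v))

Is2RDF-from-surplus : (G : Graph) (f : Labeling G) →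
  (∀ v → val {G} f v < 2 → 2 ≤ val {G} f v + surplus G f v) → Is2RDF G f
Is2RDF-from-surplus G f enough v fv<2 = begin
  2 + a        ≡⟨ +-comm 2 a ⟩
  a + 2        ≤⟨ +-monoʳ-≤ a (enough v fv<2) ⟩
  a + (x + s)  ≡⟨ x∙yz≈y∙xz a x s ⟩
  x + (a + s)  ≡⟨ cong (x +_) (sym (sum-map≡length-positive+sum-map-pred (val {G} f) (N G v))) ⟩
  fN[ G ] f v  ∎
  where
  open ≤-Reasoning
  x = val {G} f v
  a = length (AN G f v)
  s = surplus G f v

adjacent⇒∈N : (G : Graph) (v : V G) {u : V G} → u ∈ verts G → T (adj G v u) → u ∈ N G v
adjacent⇒∈N G v u∈V uv = ∈-filter⁺ _ u∈V (to T-≡ uv)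

∈-verts-C3□P : ∀ {n} (v : V (C3□P n)) → v ∈ verts (C3□P n)
∈-verts-C3□P (i , j) = ∈-cartesianProduct⁺ (∈-allFin i) (∈-allFin j)

column-adjacent : ∀ {n} {i i′ : Fin 3} (j : Fin n) → i ≢ i′ → T (adj (C3□P n) (i , j) (i′ , j))
column-adjacent {i = i} {i′} j i≢i′ with i ≟F i′ | j ≟F j
... | yes i≡i′ | _       = ⊥-elim (i≢i′ i≡i′)
... | no _     | yes _   = _
... | no _     | no j≢j  = ⊥-elim (j≢j refl)

row-adjacent : ∀ {n} (i : Fin 3) {j j′ : Fin n} →
  toℕ j′ ≡ suc (toℕ j) ⊎ toℕ j ≡ suc (toℕ j′) → T (adj (C3□P n) (i , j) (i , j′))
row-adjacent i {j} {j′} consecutive with i ≟F i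
... | no i≢i = ⊥-elim (i≢i refl)
... | yes _  = from T-∨ (Sum.map (≡⇒≡ᵇ _ (toℕ j′) ∘ sym) (≡⇒≡ᵇ _ (toℕ j) ∘ sym) consecutive)

column-neighbour : ∀ {n} {i i′ : Fin 3} (j : Fin n) → i ≢ i′ → (i′ , j) ∈ N (C3□P n) (i , j)
column-neighbour {i = i} j i≢i′ =
  adjacent⇒∈N (C3□P _) (i , j) (∈-verts-C3□P _) (column-adjacent j i≢i′)

row-neighbour : ∀ {n} (i : Fin 3) {j j′ : Fin n} →
  toℕ j′ ≡ suc (toℕ j) ⊎ toℕ j ≡ suc (toℕ j′) → (i , j′) ∈ N (C3□P n) (i , j)
row-neighbour i {j} consecutive =
  adjacent⇒∈N (C3□P _) (i , j) (∈-verts-C3□P _) (row-adjacent i consecutive)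

next : Fin 3 → Fin 3
next 0F = 1F
next 1F = 2F
next 2F = 0F

prev : Fin 3 → Fin 3
prev 0F = 2F
prev 1F = 0F
prev 2F = 1F

next≢id : ∀ ρ → next ρ ≢ ρ
next≢id 0F ()
next≢id 1F ()
next≢id 2F ()

prev≢id : ∀ ρ → prev ρ ≢ ρ
prev≢id 0F ()
prev≢id 1F ()
prev≢id 2F ()

prev∘next : ∀ ρ → prev (next ρ) ≡ ρ
prev∘next 0F = refl
prev∘next 1F = refl
prev∘next 2F = refl

data Offset (ρ : Fin 3) : Fin 3 → Set where
  centre : Offset ρ ρ
  ahead  : Offset ρ (next ρ)
  behind : Offset ρ (prev ρ)

offset : ∀ ρ i → Offset ρ i
offset 0F 0F = centre
offset 0F 1F = ahead
offset 0F 2F = behind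
offset 1F 0F = behind
offset 1F 1F = centre
offset 1F 2F = ahead
offset 2F 0F = ahead
offset 2F 1F = behind
offset 2F 2F = centre

oneIf : Bool → Fin 4
oneIf false = 0F
oneIf true  = 1F

offsetLabel : ∀ {ρ i} → Offset ρ i → (first last : Bool) → Fin 4
offsetLabel centre _     _    = 2F
offsetLabel ahead  _     last = oneIf last
offsetLabel behind first _    = oneIf first

offsetLabel-centre : ∀ ρ first last → offsetLabel (offset ρ ρ) first last ≡ 2F
offsetLabel-centre 0F _ _ = refl
offsetLabel-centre 1F _ _ = refl
offsetLabel-centre 2F _ _ = refl

column-weight : ∀ ρ first last →
  ∑[ i < 3 ] toℕ (offsetLabel (offset ρ i) first last) ≡ 2 + toℕ (oneIf first) + toℕ (oneIf last)
column-weight 0F false false = refl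
column-weight 0F false true  = refl
column-weight 0F true  false = refl
column-weight 0F true  true  = refl
column-weight 1F false false = refl
column-weight 1F false true  = refl
column-weight 1F true  false = refl
column-weight 1F true  true  = refl
column-weight 2F false false = refl
column-weight 2F false true  = refl
column-weight 2F true  false = refl
column-weight 2F true  true  = refl

centreRow : ℕ → Fin 3
centreRow zero    = 0F
centreRow (suc c) = next (centreRow c)

isFirst isLast : ∀ {n} → Fin n → Bool
isFirst j = does (toℕ j ≟ 0)
isLast {n} j = does (suc (toℕ j) ≟ n)

diagonal : (n : ℕ) → Labeling (C3□P n)
diagonal n (i , j) = offsetLabel (offset (centreRow (toℕ j)) i) (isFirst j) (isLast j)

∑-oneIf-toℕ≟ : ∀ n k → ∑[ j < n ] toℕ (oneIf (does (toℕ j ≟ k))) ≤ 1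
∑-oneIf-toℕ≟ zero    k       = z≤n
∑-oneIf-toℕ≟ (suc n) zero    = ≤-reflexive (cong suc (sum-replicate-zero n))
∑-oneIf-toℕ≟ (suc n) (suc k) = ∑-oneIf-toℕ≟ n k

∑-oneIf-isLast : ∀ n → ∑[ j < n ] toℕ (oneIf (isLast j)) ≤ 1
∑-oneIf-isLast zero    = z≤n
∑-oneIf-isLast (suc n) = ∑-oneIf-toℕ≟ (suc n) n

diagonal-weight : ∀ n → weight (C3□P n) (diagonal n) ≤ 2 * n + 2
diagonal-weight n = begin
  weight (C3□P n) (diagonal n)
    ≡⟨ sum-map-cartesianProduct-allFin (val {C3□P n} (diagonal n)) ⟩
  ∑[ i < 3 ] ∑[ j < n ] h i j
    ≡⟨ ∑-comm h ⟩
  ∑[ j < n ] ∑[ i < 3 ] h i j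
    ≡⟨ sum-cong-≗ (λ (j : Fin n) → column-weight (centreRow (toℕ j)) (isFirst j) (isLast j)) ⟩
  ∑[ j < n ] (2 + F j + L j)
    ≡⟨ ∑-distrib-+ (λ j → 2 + F j) L ⟩
  ∑[ j < n ] (2 + F j) + ∑[ j < n ] L j
    ≡⟨ cong (_+ ∑[ j < n ] L j) (∑-distrib-+ (λ _ → 2) F) ⟩
  ∑[ j < n ] 2 + ∑[ j < n ] F j + ∑[ j < n ] L j
    ≤⟨ +-mono-≤ (+-mono-≤ (≤-reflexive (∑-const n 2)) (∑-oneIf-toℕ≟ n 0)) (∑-oneIf-isLast n) ⟩
  n * 2 + 1 + 1
    ≡⟨ trans (+-assoc (n * 2) 1 1) (cong (_+ 2) (*-comm n 2)) ⟩
  2 * n + 2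
    ∎
  where
  open ≤-Reasoning
  h : Fin 3 → Fin n → ℕ
  h i j = val {C3□P n} (diagonal n) (i , j)
  F L : Fin n → ℕ
  F j = toℕ (oneIf (isFirst j))
  L j = toℕ (oneIf (isLast j))

module _ (n : ℕ) where

  private
    G = C3□P n
    f = diagonal n

  centre-label : (j : Fin n) → val {G} f (centreRow (toℕ j) , j) ≡ 2
  centre-label j = cong toℕ (offsetLabel-centre (centreRow (toℕ j)) _ _)

  surplus-from-column : ∀ {i} (j : Fin n) → i ≢ centreRow (toℕ j) → 1 ≤ surplus G f (i , j)
  surplus-from-column {i} j i≢ρ = begin
    1                                         ≡⟨ cong (_∸ 1) (sym (centre-label j)) ⟩
    val {G} f (centreRow (toℕ j) , j) ∸ 1     ≤⟨ ∈⇒≤sum-map _ (column-neighbour j i≢ρ) ⟩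
    surplus G f (i , j)                       ∎
    where open ≤-Reasoning

  surplus-from-column-and-row : ∀ {i} {j j′ : Fin n} → i ≢ centreRow (toℕ j) → i ≡ centreRow (toℕ j′) →
    toℕ j′ ≡ suc (toℕ j) ⊎ toℕ j ≡ suc (toℕ j′) → 2 ≤ surplus G f (i , j)
  surplus-from-column-and-row {j = j} {j′} i≢ρ refl consecutive = begin
    2
      ≡⟨ cong₂ (λ a b → a ∸ 1 + (b ∸ 1)) (sym (centre-label j)) (sym (centre-label j′)) ⟩
    (val {G} f (centreRow (toℕ j) , j) ∸ 1) + (val {G} f (centreRow (toℕ j′) , j′) ∸ 1)
      ≤⟨ ∈-≢-∈⇒+≤sum-map _ (column-neighbour j i≢ρ) (row-neighbour _ consecutive)
                           (λ eq → i≢ρ (sym (cong proj₁ eq))) ⟩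
    surplus G f (centreRow (toℕ j′) , j)
      ∎
    where open ≤-Reasoning

  diagonal-dominates : ∀ {i} (j : Fin n) (o : Offset (centreRow (toℕ j)) i) {first last : Bool} →
    Reflects (toℕ j ≡ 0) first → Reflects (suc (toℕ j) ≡ n) last →
    toℕ (offsetLabel o first last) < 2 → 2 ≤ toℕ (offsetLabel o first last) + surplus G f (i , j)
  diagonal-dominates j centre _ _ (s≤s (s≤s ()))
  diagonal-dominates j ahead _ (ofʸ _) _ = s≤s (surplus-from-column j (next≢id _))
  diagonal-dominates j ahead _ (ofⁿ notLast) _
    with j′ , j′≡1+j ← next-column j notLast
    = surplus-from-column-and-row (next≢id _) (cong centreRow (sym j′≡1+j)) (inj₁ j′≡1+j)
  diagonal-dominates j behind (ofʸ _) _ _ = s≤s (surplus-from-column j (prev≢id _))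
  diagonal-dominates j behind (ofⁿ notFirst) _ _
    with j′ , j≡1+j′ ← previous-column j notFirst
    = surplus-from-column-and-row (prev≢id _)
        (trans (cong (prev ∘ centreRow) j≡1+j′) (prev∘next _)) (inj₂ j≡1+j′)

  diagonal-is-2RDF : Is2RDF G f
  diagonal-is-2RDF = Is2RDF-from-surplus G f λ { (i , j) →
    diagonal-dominates j (offset (centreRow (toℕ j)) i) (proof (toℕ j ≟ 0)) (proof (suc (toℕ j) ≟ n)) }

γ[2]R≤-C3□P : ∀ n → γ[2]R≤ (C3□P n) (2 * n + 2)
γ[2]R≤-C3□P n = diagonal n , diagonal-is-2RDF n , diagonal-weight n

-- The construction needs no lower bound on n.
mainTheorem10 : (n : ℕ) → 4 ≤ n → γ[2]R≤ (C3□P n) (2 * n + 2)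
mainTheorem10 n _ = γ[2]R≤-C3□P n
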